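{- Let $\lambda$ be a triangular partition with $|\lambda|=N$ and $\theta$ its top-down tableau. Then the top-down tableau corresponds to a maximal chain of the $\nu$-Tamari lattice of $\lambda$: for every $1\le k\le N$, the subpartition formed by the cells with labels $<k$ is obtained from the subpartition formed by the cells with labels $\le k$ by a single $\nu$-Tamari rotation.
   Context: Partitions are drawn in French convention; line $k\ge1$ of $\lambda$ is its $k$-th row from the bottom, with $\lambda_k$ cells. A partition is triangular if there exist positive reals $r,s$ with $\lambda_j=\lfloor r-jr/s\rfloor$ for $1\le j\le s$ and $\lambda_j=0$ for $j>s$. The top-down tableau of $\lambda$ is the standard Young tableau obtained by labeling with $N$ the last cell of the top row, with $N-1$ the last cell of the row below, and so on, one cell per nonempty row down to the bottom row, then repeating the process on the remaining cells with the next smaller labels. $\nu$-Tamari rotation: for a subpartition $\mu\subseteq\lambda$ and a line $j$ with $\mu_j>\mu_{j+1}$, let $v=\lambda_j-\mu_j$ and let $i$ be the smallest integer with $0\le i<j$ such that $\lambda_k-\mu_k>v$ for all $i<k<j$; the rotation of $\mu$ at line $j$ is the subpartition $\alpha$ with $\alpha_k=\mu_k-1$ for $i<k\le j$ and $\alpha_k=\mu_k$ otherwise. The $\nu$-Tamari lattice of $\lambda$ is the order on subpartitions of $\lambda$ given by the reflexive-transitive closure of rotations.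
   Formalization: The parameters r and s in the definition of a triangular partition range over the positive rationals instead of the positive reals. -}

module Defs where

open import Data.Nat using (ℕ; zero; suc; _+_; _∸_; _≤_; _<_; _≡ᵇ_; _<ᵇ_)
open import Data.Bool using (Bool; true; false; _∧_; if_then_else_)
open import Data.List using (List; []; _∷_; _++_; length)
open import Data.Nat.ListAction using (sum)
open import Data.Product using (Σ; _×_; _,_; proj₁; proj₂)
open import Data.Sum using (_⊎_)
open import Data.Integer using (ℤ; +_)
open import Data.Rational using (ℚ; 0ℚ; _-_; _*_; _÷_; floor; _/_)
  renaming (_<_ to _<ℚ_; _≤_ to _≤ℚ_)
open import Data.Rational.Properties using (pos⇒nonZero)
import Data.Rational as ℚ
open import Relation.Nullary using (¬_)
open import Relation.Binary.PropositionalEquality using (_≡_)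

-- A partition is given by the list of
-- its row lengths from the bottom: λ = λ₁ ∷ λ₂ ∷ … .  Lines are indexed
-- from 1; line k of λ is `line λ k`, which is 0 beyond the list.
-- (`line λ 0` is an unused dummy value 0.)

line : List ℕ → ℕ → ℕ
line []       _             = 0
line (x ∷ xs) zero          = 0
line (x ∷ xs) (suc zero)    = x
line (x ∷ xs) (suc (suc k)) = line xs (suc k)

size : List ℕ → ℕ
size = sum

ℕtoℚ : ℕ → ℚ
ℕtoℚ j = (+ j) / 1

Triangular : List ℕ → Set
Triangular lam =
  Σ ℚ λ r → Σ ℚ λ s → Σ (0ℚ <ℚ r) λ _ → Σ (0ℚ <ℚ s) λ s>0 →
    (j : ℕ) → 1 ≤ j →
      ((ℕtoℚ j ≤ℚ s →
          + (line lam j) ≡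
            floor (r - _÷_ (ℕtoℚ j * r) s {{pos⇒nonZero s {{ℚ.positive s>0}}}}))
      × (s <ℚ ℕtoℚ j → line lam j ≡ 0))

-- Top-down tableau.
-- A cell is (row , column), both 1-based.

Cell : Set
Cell = ℕ × ℕ

-- One pass over the current shape (rows j, j+1, … given as a list from the
-- bottom), removing the last cell of every nonempty row, going from the top
-- row down.
pass : ℕ → List ℕ → List Cell × List ℕ
pass j []       = [] , []
pass j (x ∷ xs) with pass (suc j) xs
... | cs , xs' = (cs ++ rm x) , (x ∸ 1) ∷ xs'
  where
  rm : ℕ → List Cell
  rm zero    = []
  rm (suc c) = (j , suc c) ∷ []

-- Repeat the pass (fuel = number of passes; |λ| passes always suffice).
removal : ℕ → List ℕ → List Cell
removal zero    μ = []
removal (suc f) μ with pass 1 μ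
... | cs , μ' = cs ++ removal f μ'

labelFrom : ℕ → List Cell → List (ℕ × Cell)
labelFrom n []       = []
labelFrom n (c ∷ cs) = (n , c) ∷ labelFrom (n ∸ 1) cs

topDown : List ℕ → List (ℕ × Cell)
topDown lam = labelFrom (size lam) (removal (size lam) lam)

countRow : (ℕ → Bool) → ℕ → List (ℕ × Cell) → ℕ
countRow p j [] = 0
countRow p j ((l , (r , c)) ∷ ts) =
  (if (r ≡ᵇ j) ∧ p l then 1 else 0) + countRow p j ts

cellsBelow : List (ℕ × Cell) → ℕ → (ℕ → ℕ)
cellsBelow θ k j = countRow (λ l → l <ᵇ k) j θ

cellsUpTo : List (ℕ × Cell) → ℕ → (ℕ → ℕ)
cellsUpTo θ k j = countRow (λ l → l <ᵇ suc k) j θ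

-- Subpartitions are given by their line functions
-- (line k for k ≥ 1).  `Rotation λ μ α` says α is the rotation of μ at
-- some line j, exactly as in the definition of the paper.

GapCond : (ℕ → ℕ) → (ℕ → ℕ) → ℕ → ℕ → ℕ → Set
GapCond lam μ v i j = (k : ℕ) → i < k → k < j → v < lam k ∸ μ k

RotationAt : (ℕ → ℕ) → (ℕ → ℕ) → (ℕ → ℕ) → ℕ → Set
RotationAt lam μ α j =
  μ (suc j) < μ j ×
  Σ ℕ λ i →
    let v = lam j ∸ μ j in
    i < j × GapCond lam μ v i j
    × ((i' : ℕ) → i' < i → ¬ GapCond lam μ v i' j)
    × ((k : ℕ) → i < k → k ≤ j → α k ≡ μ k ∸ 1)
    × ((k : ℕ) → 1 ≤ k → (k ≤ i ⊎ j < k) → α k ≡ μ k)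

Rotation : (ℕ → ℕ) → (ℕ → ℕ) → (ℕ → ℕ) → Set
Rotation lam μ α = Σ ℕ λ j → 1 ≤ j × RotationAt lam μ α j

-- The top-down tableau is a sequence of passes, each removing the last cell
-- of every nonempty row from the top row down, and the cells with label ≤ k
-- are those not yet removed.  So if the cell labelled k is the last cell of
-- row J in pass p + 1, the cells with label ≤ k form λ minus p cells in each
-- row up to J and minus p + 1 cells in each row above J.  Removing that cell
-- is a rotation at line J with i = J − 1: every row r ≤ J has λ_r − μ_r = p,
-- which is v = λ_J − μ_J, so no smaller i meets the gap condition.
-- Triangularity is only needed to know that λ is a partition.
module Submission where

open import Defs
open import Data.Nat using (ℕ; zero; suc; _+_; _∸_; _≤_; _<_; _≡ᵇ_; _<ᵇ_; z≤n; s≤s; s≤s⁻¹)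
open import Data.Nat.Properties
open import Data.Nat.ListAction using (sum)
open import Algebra.Properties.CommutativeSemigroup +-commutativeSemigroup using (x∙yz≈y∙xz)
open import Data.Bool using (true; false; if_then_else_)
open import Data.Bool.Properties using (∧-identityʳ; ∧-zeroʳ)
open import Data.List using (List; []; _∷_; _++_; _∷ʳ_; length; map; drop; applyDownFrom)
open import Data.List.Properties using (map-++; ++-identityʳ; length-map; length-++; length-applyDownFrom; drop-[])
open import Data.Product using (_,_; proj₁; proj₂)
open import Data.Sum using (_⊎_; inj₁; inj₂)
open import Data.Empty using (⊥-elim)
open import Function using (_∘_)
open import Relation.Nullary using (yes; no; ¬_)
open import Relation.Nullary.Reflects using (Reflects; ofʸ; ofⁿ; fromEquivalence)
open import Relation.Binary.PropositionalEquality using (_≡_; refl; sym; trans; cong; cong₂; subst; subst₂; module ≡-Reasoning)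
open import Data.Integer as ℤ using (+≤+)
import Data.Integer.Properties as ℤP
import Data.Integer.DivMod as ℤD
import Data.Rational as ℚ
import Data.Rational.Properties as ℚP
open import Data.Nat.Coprimality using (1-coprimeTo) renaming (sym to coprime-sym)

Decreasing : (ℕ → ℕ) → Set
Decreasing L = ∀ r → 1 ≤ r → L (suc r) ≤ L r

/ℕ-mono-≤ : ∀ a c b-1 d-1 → let b = suc b-1; d = suc d-1 in
            a ℤ.* ℤ.+ d ℤ.≤ c ℤ.* ℤ.+ b → a ℤ./ℕ b ℤ.≤ c ℤ./ℕ d
/ℕ-mono-≤ a c b-1 d-1 ad≤cb = ℤP.≤-trans (ℤP.i<j⇒i≤pred[j] f<g+1) (ℤP.≤-reflexive (ℤP.pred-suc g))
  where
  open ℤP.≤-Reasoning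
  b = suc b-1
  d = suc d-1
  f = a ℤ./ℕ b
  g = c ℤ./ℕ d
  fd≤c : f ℤ.* ℤ.+ d ℤ.≤ c
  fd≤c = ℤP.*-cancelʳ-≤-pos (f ℤ.* ℤ.+ d) c (ℤ.+ b) (begin
    f ℤ.* ℤ.+ d ℤ.* ℤ.+ b   ≡⟨ ℤP.*-assoc f (ℤ.+ d) (ℤ.+ b) ⟩
    f ℤ.* (ℤ.+ d ℤ.* ℤ.+ b) ≡⟨ cong (f ℤ.*_) (ℤP.*-comm (ℤ.+ d) (ℤ.+ b)) ⟩
    f ℤ.* (ℤ.+ b ℤ.* ℤ.+ d) ≡⟨ ℤP.*-assoc f (ℤ.+ b) (ℤ.+ d) ⟨
    f ℤ.* ℤ.+ b ℤ.* ℤ.+ d   ≤⟨ ℤP.*-monoʳ-≤-nonNeg (ℤ.+ d) (ℤD.[n/ℕd]*d≤n a b) ⟩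
    a ℤ.* ℤ.+ d           ≤⟨ ad≤cb ⟩
    c ℤ.* ℤ.+ b           ∎)
  f<g+1 : f ℤ.< ℤ.suc g
  f<g+1 = ℤP.*-cancelʳ-<-nonNeg (ℤ.+ d) (ℤP.≤-<-trans fd≤c (ℤD.n<s[n/ℕd]*d c d))

floor-mono-≤ : ∀ {p q} → p ℚ.≤ q → ℚ.floor p ℤ.≤ ℚ.floor q
floor-mono-≤ {ℚ.mkℚ a b-1 _} {ℚ.mkℚ c d-1 _} (ℚ.*≤* ad≤cb) =
  subst₂ ℤ._≤_ (sym (ℤD.div-pos-is-/ℕ a (suc b-1))) (sym (ℤD.div-pos-is-/ℕ c (suc d-1)))
    (/ℕ-mono-≤ a c b-1 d-1 ad≤cb)

ℕtoℚ-mono-suc : ∀ j → ℕtoℚ j ℚ.≤ ℕtoℚ (suc j)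
ℕtoℚ-mono-suc j rewrite ℚP.normalize-coprime (coprime-sym (1-coprimeTo j))
                      | ℚP.normalize-coprime (coprime-sym (1-coprimeTo (suc j))) =
  ℚ.*≤* (ℤP.*-monoʳ-≤-nonNeg (ℤ.+ 1) (+≤+ (n≤1+n j)))

triangle-antitone : ∀ r s .{{_ : ℚ.Positive r}} .{{_ : ℚ.Positive s}} j →
  let instance _ = ℚP.pos⇒nonZero s in
  r ℚ.- (ℕtoℚ (suc j) ℚ.* r) ℚ.÷ s ℚ.≤ r ℚ.- (ℕtoℚ j ℚ.* r) ℚ.÷ s
triangle-antitone r s j = ℚP.+-monoʳ-≤ r (ℚP.neg-antimono-≤
  (ℚP.*-monoʳ-≤-nonNeg (ℚ.1/ s) {{ℚP.pos⇒nonNeg (ℚ.1/ s) {{ℚP.1/pos⇒pos s}}}}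
    (ℚP.*-monoʳ-≤-nonNeg r {{ℚP.pos⇒nonNeg r}} (ℕtoℚ-mono-suc j))))
  where instance _ = ℚP.pos⇒nonZero s

triangular⇒decreasing : ∀ {xs} → Triangular xs → Decreasing (line xs)
triangular⇒decreasing {xs} (r , s , r>0 , s>0 , tri) j 1≤j with s ℚP.<? ℕtoℚ (suc j)
... | yes s<j+1 = subst (_≤ line xs j) (sym (proj₂ (tri (suc j) (s≤s z≤n)) s<j+1)) z≤n
... | no s≮j+1 = ℤP.drop‿+≤+ (subst₂ ℤ._≤_
  (sym (proj₁ (tri (suc j) (s≤s z≤n)) j+1≤s)) (sym (proj₁ (tri j 1≤j) j≤s))
  (floor-mono-≤ (triangle-antitone r s {{ℚ.positive r>0}} {{ℚ.positive s>0}} j)))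
  where
  j+1≤s = ℚP.≮⇒≥ s≮j+1
  j≤s = ℚP.≤-trans (ℕtoℚ-mono-suc j) j+1≤s

nonemptyRows : List ℕ → ℕ
nonemptyRows []           = 0
nonemptyRows (zero  ∷ xs) = 0
nonemptyRows (suc x ∷ xs) = suc (nonemptyRows xs)

peel : List ℕ → List ℕ
peel xs = proj₂ (pass 1 xs)

LinesAtMost : ℕ → List ℕ → Set
LinesAtMost f xs = ∀ r → line xs r ≤ f

line-zero : ∀ xs → line xs 0 ≡ 0
line-zero []       = refl
line-zero (x ∷ xs) = refl

line-≤-sum : ∀ xs → LinesAtMost (sum xs) xs
line-≤-sum []       r             = z≤n
line-≤-sum (x ∷ xs) zero          = z≤n
line-≤-sum (x ∷ xs) (suc zero)    = m≤m+n x (sum xs)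
line-≤-sum (x ∷ xs) (suc (suc r)) = ≤-trans (line-≤-sum xs (suc r)) (m≤n+m (sum xs) x)

linesAtMost-zero⇒sum≡0 : ∀ xs → LinesAtMost 0 xs → sum xs ≡ 0
linesAtMost-zero⇒sum≡0 []       _ = refl
linesAtMost-zero⇒sum≡0 (x ∷ xs) b with b 1
... | z≤n = linesAtMost-zero⇒sum≡0 xs λ { zero → ≤-reflexive (line-zero xs) ; (suc r) → b (suc (suc r)) }

decreasing-tail : ∀ {x xs} → Decreasing (line (x ∷ xs)) → Decreasing (line xs)
decreasing-tail d (suc r) _ = d (suc (suc r)) (s≤s z≤n)

nonemptyRows-after-zero : ∀ xs → Decreasing (line (0 ∷ xs)) → nonemptyRows xs ≡ 0
nonemptyRows-after-zero []           d = refl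
nonemptyRows-after-zero (zero  ∷ xs) d = refl
nonemptyRows-after-zero (suc x ∷ xs) d with d 1 (s≤s z≤n)
... | ()

line-within-nonemptyRows : ∀ xs → Decreasing (line xs) → ∀ r → 1 ≤ r → r ≤ nonemptyRows xs → 0 < line xs r
line-within-nonemptyRows (suc x ∷ xs) d (suc zero)    _ _           = s≤s z≤n
line-within-nonemptyRows (suc x ∷ xs) d (suc (suc r)) _ (s≤s r≤c) = line-within-nonemptyRows xs (decreasing-tail d) (suc r) (s≤s z≤n) r≤c

line-pass : ∀ j xs r → line (proj₂ (pass j xs)) r ≡ line xs r ∸ 1
line-pass j []       r             = refl
line-pass j (x ∷ xs) zero          = refl
line-pass j (x ∷ xs) (suc zero)    = refl
line-pass j (x ∷ xs) (suc (suc r)) = line-pass (suc j) xs (suc r)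

decreasing-peel : ∀ xs → Decreasing (line xs) → Decreasing (line (peel xs))
decreasing-peel xs d r 1≤r rewrite line-pass 1 xs (suc r) | line-pass 1 xs r = ∸-monoˡ-≤ 1 (d r 1≤r)

linesAtMost-peel : ∀ {f} xs → LinesAtMost (suc f) xs → LinesAtMost f (peel xs)
linesAtMost-peel xs b r rewrite line-pass 1 xs r = ∸-monoˡ-≤ 1 (b r)

sum-pass : ∀ j xs → Decreasing (line xs) → sum xs ≡ nonemptyRows xs + sum (proj₂ (pass j xs))
sum-pass j []           d = refl
sum-pass j (zero  ∷ xs) d
  rewrite sum-pass (suc j) xs (decreasing-tail d) | nonemptyRows-after-zero xs d = refl
sum-pass j (suc x ∷ xs) d
  rewrite sum-pass (suc j) xs (decreasing-tail d) =
  cong suc (x∙yz≈y∙xz x (nonemptyRows xs) _)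

applyDownFrom-+-∷ʳ : ∀ j c → applyDownFrom (suc j +_) c ∷ʳ j ≡ applyDownFrom (j +_) (suc c)
applyDownFrom-+-∷ʳ j zero    = cong (_∷ []) (sym (+-identityʳ j))
applyDownFrom-+-∷ʳ j (suc c) = cong₂ _∷_ (sym (+-suc j c)) (applyDownFrom-+-∷ʳ j c)

rows-pass : ∀ j xs → Decreasing (line xs) →
            map proj₁ (proj₁ (pass j xs)) ≡ applyDownFrom (j +_) (nonemptyRows xs)
rows-pass j [] d = refl
rows-pass j (zero ∷ xs) d = begin
  map proj₁ (proj₁ (pass (suc j) xs) ++ [])   ≡⟨ cong (map proj₁) (++-identityʳ _) ⟩
  map proj₁ (proj₁ (pass (suc j) xs))         ≡⟨ rows-pass (suc j) xs (decreasing-tail d) ⟩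
  applyDownFrom (suc j +_) (nonemptyRows xs)  ≡⟨ cong (applyDownFrom (suc j +_)) (nonemptyRows-after-zero xs d) ⟩
  []                                          ∎
  where open ≡-Reasoning
rows-pass j (suc x ∷ xs) d = begin
  map proj₁ (proj₁ (pass (suc j) xs) ∷ʳ (j , suc x))    ≡⟨ map-++ proj₁ (proj₁ (pass (suc j) xs)) _ ⟩
  map proj₁ (proj₁ (pass (suc j) xs)) ∷ʳ j               ≡⟨ cong (_∷ʳ j) (rows-pass (suc j) xs (decreasing-tail d)) ⟩
  applyDownFrom (suc j +_) (nonemptyRows xs) ∷ʳ j        ≡⟨ applyDownFrom-+-∷ʳ j (nonemptyRows xs) ⟩
  applyDownFrom (j +_) (suc (nonemptyRows xs))           ∎
  where open ≡-Reasoning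

removalRows : ℕ → List ℕ → List ℕ
removalRows f xs = map proj₁ (removal f xs)

removalRows-suc : ∀ f xs → Decreasing (line xs) →
  removalRows (suc f) xs ≡ applyDownFrom suc (nonemptyRows xs) ++ removalRows f (peel xs)
removalRows-suc f xs d =
  trans (map-++ proj₁ (proj₁ (pass 1 xs)) _) (cong (_++ removalRows f (peel xs)) (rows-pass 1 xs d))

occurrences : ℕ → List ℕ → ℕ
occurrences r []       = 0
occurrences r (x ∷ xs) = (if x ≡ᵇ r then 1 else 0) + occurrences r xs

occurrences-++ : ∀ r xs ys → occurrences r (xs ++ ys) ≡ occurrences r xs + occurrences r ys
occurrences-++ r []       ys = refl
occurrences-++ r (x ∷ xs) ys =
  trans (cong (_ +_) (occurrences-++ r xs ys)) (sym (+-assoc (if x ≡ᵇ r then 1 else 0) _ _))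

≡ᵇ-reflects-≡ : ∀ m n → Reflects (m ≡ n) (m ≡ᵇ n)
≡ᵇ-reflects-≡ m n = fromEquivalence (≡ᵇ⇒≡ m n) (≡⇒≡ᵇ m n)

occurrences-zero-downFrom : ∀ c → occurrences 0 (applyDownFrom suc c) ≡ 0
occurrences-zero-downFrom zero    = refl
occurrences-zero-downFrom (suc c) = occurrences-zero-downFrom c

occurrences-downFrom-> : ∀ {r} c → c < r → occurrences r (applyDownFrom suc c) ≡ 0
occurrences-downFrom-> zero    _   = refl
occurrences-downFrom-> {r} (suc c) c<r with suc c ≡ᵇ r | ≡ᵇ-reflects-≡ (suc c) r
... | true  | ofʸ refl = ⊥-elim (<-irrefl refl c<r)
... | false | ofⁿ _    = occurrences-downFrom-> c (<-trans (n<1+n c) c<r)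

occurrences-downFrom-≤ : ∀ {r} c → 1 ≤ r → r ≤ c → occurrences r (applyDownFrom suc c) ≡ 1
occurrences-downFrom-≤ zero (s≤s z≤n) ()
occurrences-downFrom-≤ {r} (suc c) 1≤r r≤c with suc c ≡ᵇ r | ≡ᵇ-reflects-≡ (suc c) r
... | true  | ofʸ refl = cong suc (occurrences-downFrom-> c ≤-refl)
... | false | ofⁿ c≢r  = occurrences-downFrom-≤ c 1≤r (s≤s⁻¹ (≤∧≢⇒< r≤c (λ r≡c → c≢r (sym r≡c))))

line-beyond-nonemptyRows : ∀ xs → Decreasing (line xs) → ∀ r → nonemptyRows xs < r → line xs r ≡ 0
line-beyond-nonemptyRows []           d r             _         = refl
line-beyond-nonemptyRows (zero  ∷ xs) d (suc zero)    _         = refl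
line-beyond-nonemptyRows (zero  ∷ xs) d (suc (suc r)) _         =
  line-beyond-nonemptyRows xs (decreasing-tail d) (suc r)
    (subst (_< suc r) (sym (nonemptyRows-after-zero xs d)) (s≤s z≤n))
line-beyond-nonemptyRows (suc x ∷ xs) d (suc (suc r)) (s≤s c<r) =
  line-beyond-nonemptyRows xs (decreasing-tail d) (suc r) c<r

drop-++ : ∀ {A : Set} m (xs ys : List A) → m ≤ length xs → drop m (xs ++ ys) ≡ drop m xs ++ ys
drop-++ zero    xs       ys _         = refl
drop-++ (suc m) (x ∷ xs) ys (s≤s m≤n) = drop-++ m xs ys m≤n

drop-length-++ : ∀ {A : Set} m (xs ys : List A) → drop (length xs + m) (xs ++ ys) ≡ drop m ys
drop-length-++ m []       ys = refl
drop-length-++ m (x ∷ xs) ys = drop-length-++ m xs ys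

drop-applyDownFrom : ∀ {A : Set} (g : ℕ → A) c m → drop m (applyDownFrom g c) ≡ applyDownFrom g (c ∸ m)
drop-applyDownFrom g c       zero    = refl
drop-applyDownFrom g zero    (suc m) = refl
drop-applyDownFrom g (suc c) (suc m) = drop-applyDownFrom g c m

record Peeled (L μ : ℕ → ℕ) (p J : ℕ) : Set where
  field
    below : ∀ r → r ≤ J → μ r ≡ L r ∸ p
    above : ∀ r → J < r → μ r ≡ L r ∸ suc p

Peeled-cong : ∀ {L μ ν p J} → (∀ r → μ r ≡ ν r) → Peeled L ν p J → Peeled L μ p J
Peeled-cong μ≗ν P = record
  { below = λ r r≤J → trans (μ≗ν r) (below r r≤J)
  ; above = λ r J<r → trans (μ≗ν r) (above r J<r)
  }
  where open Peeled P

Peeled-peel : ∀ {xs μ p J} → Peeled (line (peel xs)) μ p J → Peeled (line xs) μ (suc p) J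
Peeled-peel {xs} {μ} {p} P = record
  { below = λ r r≤J → trans (below r r≤J) (peel-∸ r p)
  ; above = λ r J<r → trans (above r J<r) (peel-∸ r (suc p))
  }
  where
  open Peeled P
  peel-∸ : ∀ r q → line (peel xs) r ∸ q ≡ line xs r ∸ suc q
  peel-∸ r q = trans (cong (_∸ q) (line-pass 1 xs r)) (∸-+-assoc (line xs r) 1 q)

record TopDownStep (L μ α : ℕ → ℕ) : Set where
  field
    depth row : ℕ
    cell      : depth < L (suc row)
    before    : Peeled L μ depth (suc row)
    after     : Peeled L α depth row

partlyPeeled : List ℕ → ℕ → ℕ → ℕ
partlyPeeled xs K r = occurrences r (applyDownFrom suc K) + line (peel xs) r

partlyPeeled-peeled : ∀ xs → Decreasing (line xs) → ∀ K → K ≤ nonemptyRows xs →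
                      Peeled (line xs) (partlyPeeled xs K) 0 K
partlyPeeled-peeled xs d K K≤c = record { below = below ; above = above }
  where
  below : ∀ r → r ≤ K → partlyPeeled xs K r ≡ line xs r
  below zero    _   rewrite occurrences-zero-downFrom K | line-pass 1 xs 0 | line-zero xs = refl
  below (suc r) r<K rewrite occurrences-downFrom-≤ K (s≤s z≤n) r<K | line-pass 1 xs (suc r) =
    m+[n∸m]≡n (line-within-nonemptyRows xs d (suc r) (s≤s z≤n) (≤-trans r<K K≤c))
  above : ∀ r → K < r → partlyPeeled xs K r ≡ line xs r ∸ 1
  above r K<r rewrite occurrences-downFrom-> K K<r = line-pass 1 xs r

partlyPeeled-topDownStep : ∀ xs → Decreasing (line xs) → ∀ K → suc K ≤ nonemptyRows xs →
                           TopDownStep (line xs) (partlyPeeled xs (suc K)) (partlyPeeled xs K)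
partlyPeeled-topDownStep xs d K K<c = record
  { depth = 0 ; row = K
  ; cell = line-within-nonemptyRows xs d (suc K) (s≤s z≤n) K<c
  ; before = partlyPeeled-peeled xs d (suc K) K<c
  ; after = partlyPeeled-peeled xs d K (<⇒≤ K<c)
  }

occurrences-removalRows : ∀ f xs → Decreasing (line xs) → LinesAtMost f xs →
  ∀ r → occurrences r (removalRows f xs) ≡ line xs r
occurrences-removalRows zero    xs d b r = sym (n≤0⇒n≡0 (b r))
occurrences-removalRows (suc f) xs d b r = begin
  occurrences r (removalRows (suc f) xs)                   ≡⟨ cong (occurrences r) (removalRows-suc f xs d) ⟩
  occurrences r (D ++ removalRows f (peel xs))             ≡⟨ occurrences-++ r D _ ⟩
  occurrences r D + occurrences r (removalRows f (peel xs)) ≡⟨ cong (occurrences r D +_) IH ⟩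
  occurrences r D + line (peel xs) r                       ≡⟨ fullPass r ⟩
  line xs r                                                ∎
  where
  open ≡-Reasoning
  c = nonemptyRows xs
  D = applyDownFrom suc c
  IH = occurrences-removalRows f (peel xs) (decreasing-peel xs d) (linesAtMost-peel xs b) r
  fullPass : ∀ r → partlyPeeled xs c r ≡ line xs r
  fullPass r with r ≤? c
  ... | yes r≤c = Peeled.below (partlyPeeled-peeled xs d c ≤-refl) r r≤c
  ... | no  r≰c = begin
    partlyPeeled xs c r                ≡⟨ Peeled.above (partlyPeeled-peeled xs d c ≤-refl) r c<r ⟩
    line xs r ∸ 1                      ≡⟨ cong (_∸ 1) empty ⟩
    0                                  ≡⟨ empty ⟨
    line xs r                          ∎
    where
    c<r = ≰⇒> r≰c
    empty = line-beyond-nonemptyRows xs d r c<r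

length-removalRows : ∀ f xs → Decreasing (line xs) → LinesAtMost f xs → length (removalRows f xs) ≡ sum xs
length-removalRows zero    xs d b = sym (linesAtMost-zero⇒sum≡0 xs b)
length-removalRows (suc f) xs d b = begin
  length (removalRows (suc f) xs)                   ≡⟨ cong length (removalRows-suc f xs d) ⟩
  length (D ++ removalRows f (peel xs))             ≡⟨ length-++ D ⟩
  length D + length (removalRows f (peel xs))       ≡⟨ cong₂ _+_ (length-applyDownFrom suc c) IH ⟩
  c + sum (peel xs)                                 ≡⟨ sum-pass 1 xs d ⟨
  sum xs                                            ∎
  where
  open ≡-Reasoning
  c = nonemptyRows xs
  D = applyDownFrom suc c
  IH = length-removalRows f (peel xs) (decreasing-peel xs d) (linesAtMost-peel xs b)

afterRemoving : ℕ → List ℕ → ℕ → ℕ → ℕ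
afterRemoving f xs m r = occurrences r (drop m (removalRows f xs))

afterRemoving-firstPass : ∀ f xs → Decreasing (line xs) → LinesAtMost (suc f) xs →
  ∀ t → t ≤ nonemptyRows xs →
  ∀ r → afterRemoving (suc f) xs t r ≡ partlyPeeled xs (nonemptyRows xs ∸ t) r
afterRemoving-firstPass f xs d b t t≤c r = begin
  occurrences r (drop t (removalRows (suc f) xs))       ≡⟨ cong (occurrences r ∘ drop t) (removalRows-suc f xs d) ⟩
  occurrences r (drop t (D ++ R))                       ≡⟨ cong (occurrences r) (drop-++ t D R t≤|D|) ⟩
  occurrences r (drop t D ++ R)                         ≡⟨ occurrences-++ r (drop t D) R ⟩
  occurrences r (drop t D) + occurrences r R            ≡⟨ cong₂ _+_ (cong (occurrences r) (drop-applyDownFrom suc c t)) IH ⟩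
  occurrences r (applyDownFrom suc (c ∸ t)) + line (peel xs) r ∎
  where
  open ≡-Reasoning
  c = nonemptyRows xs
  D = applyDownFrom suc c
  R = removalRows f (peel xs)
  t≤|D| = subst (t ≤_) (sym (length-applyDownFrom suc c)) t≤c
  IH = occurrences-removalRows f (peel xs) (decreasing-peel xs d) (linesAtMost-peel xs b) r

afterRemoving-laterPass : ∀ f xs → Decreasing (line xs) →
  ∀ t r → afterRemoving (suc f) xs (nonemptyRows xs + t) r ≡ afterRemoving f (peel xs) t r
afterRemoving-laterPass f xs d t r = cong (occurrences r) (begin
  drop (c + t) (removalRows (suc f) xs)   ≡⟨ cong (drop (c + t)) (removalRows-suc f xs d) ⟩
  drop (c + t) (D ++ R)                   ≡⟨ cong (λ n → drop (n + t) (D ++ R)) (length-applyDownFrom suc c) ⟨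
  drop (length D + t) (D ++ R)            ≡⟨ drop-length-++ t D R ⟩
  drop t R                                ∎)
  where
  open ≡-Reasoning
  c = nonemptyRows xs
  D = applyDownFrom suc c
  R = removalRows f (peel xs)

TopDownStep-cong : ∀ {L μ μ′ α α′} → (∀ r → μ r ≡ μ′ r) → (∀ r → α r ≡ α′ r) →
                   TopDownStep L μ′ α′ → TopDownStep L μ α
TopDownStep-cong μ≗μ′ α≗α′ S = record
  { depth = depth ; row = row ; cell = cell
  ; before = Peeled-cong μ≗μ′ before ; after = Peeled-cong α≗α′ after }
  where open TopDownStep S

TopDownStep-peel : ∀ {xs μ α} → TopDownStep (line (peel xs)) μ α → TopDownStep (line xs) μ α
TopDownStep-peel {xs} S = record
  { depth = suc depth ; row = row
  ; cell = <-pred⇒suc-< (subst (depth <_) (line-pass 1 xs (suc row)) cell)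
  ; before = Peeled-peel {xs} before ; after = Peeled-peel {xs} after }
  where
  open TopDownStep S
  <-pred⇒suc-< : ∀ {a b} → a < b ∸ 1 → suc a < b
  <-pred⇒suc-< {b = suc b} a<b = s≤s a<b

afterRemoving-topDownStep : ∀ f xs → Decreasing (line xs) → LinesAtMost f xs → ∀ m → m < sum xs →
  TopDownStep (line xs) (afterRemoving f xs m) (afterRemoving f xs (suc m))
afterRemoving-topDownStep zero xs d b m m<S =
  ⊥-elim (n≮0 (subst (m <_) (linesAtMost-zero⇒sum≡0 xs b) m<S))
afterRemoving-topDownStep (suc f) xs d b m m<S with m <? nonemptyRows xs
... | yes m<c = TopDownStep-cong
  (λ r → trans (afterRemoving-firstPass f xs d b m (<⇒≤ m<c) r) (cong (λ K → partlyPeeled xs K r) c∸m≡1+K))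
  (afterRemoving-firstPass f xs d b (suc m) m<c)
  (partlyPeeled-topDownStep xs d K (subst (_≤ c) c∸m≡1+K (m∸n≤m c m)))
  where
  c = nonemptyRows xs
  K = c ∸ suc m
  c∸m≡1+K : c ∸ m ≡ suc K
  c∸m≡1+K = +-∸-assoc 1 m<c
... | no m≮c = TopDownStep-cong
  (λ r → trans (cong (λ n → afterRemoving (suc f) xs n r) (sym c+m′≡m)) (afterRemoving-laterPass f xs d m′ r))
  (λ r → trans (cong (λ n → afterRemoving (suc f) xs n r) (sym c+1+m′≡1+m)) (afterRemoving-laterPass f xs d (suc m′) r))
  (TopDownStep-peel {xs}
    (afterRemoving-topDownStep f (peel xs) (decreasing-peel xs d) (linesAtMost-peel xs b) m′ m′<S))
  where
  c = nonemptyRows xs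
  m′ = m ∸ c
  c+m′≡m : c + m′ ≡ m
  c+m′≡m = m+[n∸m]≡n (≮⇒≥ m≮c)
  c+1+m′≡1+m : c + suc m′ ≡ suc m
  c+1+m′≡1+m = trans (+-suc c m′) (cong suc c+m′≡m)
  m′<S : m′ < sum (peel xs)
  m′<S = +-cancelˡ-< c m′ (sum (peel xs)) (subst₂ _<_ (sym c+m′≡m) (sum-pass 1 xs d) m<S)

topDownStep⇒rotation : ∀ {L μ α} → Decreasing L → TopDownStep L μ α → Rotation L μ α
topDownStep⇒rotation {L} {μ} {α} dec S =
  J , s≤s z≤n , μ-drops , i , ≤-refl , gap , minimal , shifted , unchanged
  where
  open TopDownStep S renaming (depth to p; row to i)
  open Peeled before renaming (below to μ-below; above to μ-above)
  open Peeled after  renaming (below to α-below; above to α-above)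
  J = suc i
  μ-drops : μ (suc J) < μ J
  μ-drops = subst₂ _<_ (sym (μ-above (suc J) ≤-refl)) (sym (μ-below J ≤-refl))
    (≤-<-trans (∸-monoˡ-≤ (suc p) (dec J (s≤s z≤n))) (∸-monoʳ-< ≤-refl cell))
  gap-below : ∀ k → k ≤ J → p ≤ L k → L k ∸ μ k ≡ p
  gap-below k k≤J p≤Lk = trans (cong (L k ∸_) (μ-below k k≤J)) (m∸[m∸n]≡n p≤Lk)
  v≡p : L J ∸ μ J ≡ p
  v≡p = gap-below J ≤-refl (<⇒≤ cell)
  gap : GapCond L μ (L J ∸ μ J) i J
  gap k i<k k<J = ⊥-elim (<⇒≱ i<k (s≤s⁻¹ k<J))
  minimal : ∀ i′ → i′ < i → ¬ GapCond L μ (L J ∸ μ J) i′ J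
  minimal i′ i′<i g = <-irrefl (sym (gap-below i (n≤1+n i) p≤Li)) (subst (_< L i ∸ μ i) v≡p (g i i′<i ≤-refl))
    where p≤Li = ≤-trans (<⇒≤ cell) (dec i (≤-trans (s≤s z≤n) i′<i))
  shifted : ∀ k → i < k → k ≤ J → α k ≡ μ k ∸ 1
  shifted k i<k k≤J = begin
    α k               ≡⟨ α-above k i<k ⟩
    L k ∸ (1 + p)     ≡⟨ cong (L k ∸_) (+-comm 1 p) ⟩
    L k ∸ (p + 1)     ≡⟨ ∸-+-assoc (L k) p 1 ⟨
    L k ∸ p ∸ 1       ≡⟨ cong (_∸ 1) (μ-below k k≤J) ⟨
    μ k ∸ 1           ∎
    where open ≡-Reasoning
  unchanged : ∀ k → 1 ≤ k → (k ≤ i ⊎ J < k) → α k ≡ μ k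
  unchanged k _ (inj₁ k≤i) = trans (α-below k k≤i) (sym (μ-below k (m≤n⇒m≤1+n k≤i)))
  unchanged k _ (inj₂ J<k) = trans (α-above k (<-trans (n<1+n i) J<k)) (sym (μ-above k J<k))

countRow-labelFrom : ∀ k (cs : List Cell) j →
  countRow (λ l → l <ᵇ suc k) j (labelFrom (length cs) cs) ≡ occurrences j (drop (length cs ∸ k) (map proj₁ cs))
countRow-labelFrom k []             j = cong (occurrences j) (sym (drop-[] (0 ∸ k)))
countRow-labelFrom k ((r , _) ∷ cs) j with length cs <ᵇ k | <ᵇ-reflects-< (length cs) k
... | true  | ofʸ n<k rewrite ∧-identityʳ (r ≡ᵇ j) | m≤n⇒m∸n≡0 n<k =
  cong (_ +_) (trans (countRow-labelFrom k cs j)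
    (cong (λ t → occurrences j (drop t (map proj₁ cs))) (m≤n⇒m∸n≡0 (<⇒≤ n<k))))
... | false | ofⁿ n≮k rewrite ∧-zeroʳ (r ≡ᵇ j) | +-∸-assoc 1 (≮⇒≥ n≮k) = countRow-labelFrom k cs j

cellsUpTo-topDown : ∀ xs → Decreasing (line xs) → ∀ k j →
  cellsUpTo (topDown xs) k j ≡ afterRemoving (sum xs) xs (sum xs ∸ k) j
cellsUpTo-topDown xs d k j =
  subst (λ n → countRow (λ l → l <ᵇ suc k) j (labelFrom n cs) ≡ occurrences j (drop (n ∸ k) (map proj₁ cs)))
    |cs|≡N (countRow-labelFrom k cs j)
  where
  cs = removal (sum xs) xs
  |cs|≡N = trans (sym (length-map proj₁ cs)) (length-removalRows (sum xs) xs d (line-≤-sum xs))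

proposition5p7 : (λ′ : List ℕ) → Triangular λ′ →
    (k : ℕ) → 1 ≤ k → k ≤ size λ′ →
      Rotation (line λ′) (cellsUpTo (topDown λ′) k) (cellsBelow (topDown λ′) k)
proposition5p7 λ′ tri (suc k) _ k<N =
  topDownStep⇒rotation dec (TopDownStep-cong (cellsUpTo-topDown λ′ dec (suc k)) α≗
    (afterRemoving-topDownStep N λ′ dec (line-≤-sum λ′) (N ∸ suc k) (∸-monoʳ-< (s≤s z≤n) k<N)))
  where
  N = size λ′
  dec = triangular⇒decreasing {λ′} tri
  α≗ : ∀ j → cellsBelow (topDown λ′) (suc k) j ≡ afterRemoving N λ′ (suc (N ∸ suc k)) j
  α≗ j = trans (cellsUpTo-topDown λ′ dec k j) (cong (λ n → afterRemoving N λ′ n j) (+-∸-assoc 1 k<N))
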